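{- For any $\delta > 0$, there is a constant $C = C(\delta)$ such that the following holds for every $n$. If $H$ is a graph on $n$ vertices satisfying $\Pr_{G \sim \mathcal{G}(n,1/2)}[G \rightarrow^* H] \geq \delta/2$, then $e(H) \ge \binom{n}{2} - Cn$.
   Context: $\mathcal{G}(n,1/2)$ is the uniformly random labelled graph on $n$ vertices. An embedding of $G$ into $H$ is an injective map $\phi: V(G)\to V(H)$ with $uv\in E(G) \Rightarrow \phi(u)\phi(v)\in E(H)$; $G \rightarrow^* H$ means there is exactly one embedding of $G$ into $H$. $e(H)$ is the number of edges of $H$. -}

module Defs where

open import Data.Nat using (ℕ; zero; suc; _+_)
open import Data.Bool using (Bool; true; false; if_then_else_)
open import Data.Fin using (Fin; zero; suc)
open import Data.Fin.Properties using (all?) renaming (_≟_ to _≟ᶠ_)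
open import Data.Bool.Properties using () renaming (_≟_ to _≟ᵇ_)
open import Data.Nat.Properties using () renaming (_≟_ to _≟ⁿ_)
open import Data.Vec using (Vec; []; _∷_; lookup)
open import Data.List using (List; []; _∷_; map; concatMap; length; filter)
open import Data.Product using (_×_; _,_)
open import Data.Unit using (⊤; tt)
open import Relation.Binary.PropositionalEquality using (_≡_)
open import Relation.Nullary using (Dec)
open import Relation.Nullary.Decidable using (_→-dec_; _×-dec_)

-- Graph (suc n) = a graph on the vertices 1..n (as `suc i`) together with
-- the neighbourhood (indicator vector over Fin n) of the new vertex 0.
-- This is a bijective encoding of simple graphs on Fin n
-- (edge-indicator of every unordered pair {i,j}, i ≠ j, exactly once).
Graph : ℕ → Set
Graph zero    = ⊤
Graph (suc n) = Graph n × Vec Bool n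

adj : ∀ {n} → Graph n → Fin n → Fin n → Bool
adj {suc n} (G , v) zero    zero    = false
adj {suc n} (G , v) zero    (suc j) = lookup v j
adj {suc n} (G , v) (suc i) zero    = lookup v i
adj {suc n} (G , v) (suc i) (suc j) = adj G i j

_~_within_ : ∀ {n} → Fin n → Fin n → Graph n → Set
u ~ v within G = adj G u v ≡ true

trues : ∀ {k} → Vec Bool k → ℕ
trues []          = 0
trues (b ∷ bs) = (if b then 1 else 0) + trues bs

e : ∀ {n} → Graph n → ℕ
e {zero}  _       = 0
e {suc n} (G , v) = e G + trues v

allBoolVecs : (k : ℕ) → List (Vec Bool k)
allBoolVecs zero    = [] ∷ []
allBoolVecs (suc k) = concatMap (λ bs → (false ∷ bs) ∷ (true ∷ bs) ∷ []) (allBoolVecs k)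

allGraphs : (n : ℕ) → List (Graph n)
allGraphs zero    = tt ∷ []
allGraphs (suc n) = concatMap (λ G → map (λ v → (G , v)) (allBoolVecs n)) (allGraphs n)

allMaps : (m n : ℕ) → List (Vec (Fin n) m)
allMaps zero    n = [] ∷ []
allMaps (suc m) n = concatMap (λ φ → map (λ x → x ∷ φ) (allFinList n)) (allMaps m n)
  where
  allFinList : (k : ℕ) → List (Fin k)
  allFinList zero    = []
  allFinList (suc k) = zero ∷ map suc (allFinList k)

IsEmbedding : ∀ {n} → Graph n → Graph n → (Fin n → Fin n) → Set
IsEmbedding {n} G H φ =
  (∀ u v → φ u ≡ φ v → u ≡ v) ×
  (∀ u v → u ~ v within G → φ u ~ φ v within H)

isEmbedding? : ∀ {n} (G H : Graph n) (φ : Fin n → Fin n) → Dec (IsEmbedding G H φ)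
isEmbedding? G H φ =
  all? (λ u → all? (λ v → (φ u ≟ᶠ φ v) →-dec (u ≟ᶠ v)))
  ×-dec
  all? (λ u → all? (λ v → (adj G u v ≟ᵇ true) →-dec (adj H (φ u) (φ v) ≟ᵇ true)))

numEmbeddings : ∀ {n} → Graph n → Graph n → ℕ
numEmbeddings {n} G H =
  length (filter (λ φ → isEmbedding? G H (lookup φ)) (allMaps n n))

_→*_ : ∀ {n} → Graph n → Graph n → Set
G →* H = numEmbeddings G H ≡ 1

-- |{ G graph on Fin n : G →* H }|; Pr_{G ~ G(n,1/2)}[G →* H] = this / 2^(n choose 2)
countUnique : ∀ {n} → Graph n → ℕ
countUnique {n} H = length (filter (λ G → numEmbeddings G H ≟ⁿ 1) (allGraphs n))

-- Let f G be 1 if G does not embed into H and 0 otherwise; adding edges can only switch f on.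
-- If G →* H via φ, adding to G a pair uv with φ u φ v a non-edge of H destroys the only
-- embedding, so the total rise ∑_{u,v} (f (G + uv) - f G) over ordered pairs is at least
-- 2 (C(n,2) - e(H)). Summed over all G, pairing (G, uv ∉ G) with (G + uv, uv) shows that the total
-- rise is 2 ∑_G f(G) a(G) with a(G) = 2 e(G) - C(n,2). Since f² ≤ 1, 2 n f a ≤ n² + a², and
-- ∑_G a(G)² = C(n,2) 2^C(n,2), this sum is at most 2 n 2^C(n,2). Hence
-- (C(n,2) - e(H)) · #{G : G →* H} ≤ n 2^C(n,2), while the hypothesis gives
-- #{G : G →* H} ≥ 2^C(n,2) / (2 ↧δ); so C(n,2) - e(H) ≤ 2 ↧δ n.
module Submission where

open import Defs

module _ where

  open import Data.Bool using (Bool; true; false)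
  open import Data.Fin using (Fin; zero; suc; punchIn; punchOut)
  open import Data.Fin.Properties using (punchIn-punchOut; punchOut-injective; suc-injective)
    renaming (_≟_ to _≟ᶠ_)
  open import Data.Integer as ℤ using (ℤ; +_; +[1+_]; -[1+_]; 0ℤ; 1ℤ; -1ℤ; _+_; _-_; _*_; -_; _≤_; +≤+)
  import Data.Integer.Properties as ℤ
  open import Algebra.Properties.Semiring.Sum ℤ.+-*-semiring
    using (sum; sum-syntax; ∑-distrib-+; sum-remove; sum-cong-≗)
  open import Data.Integer.Tactic.RingSolver using (solve-∀)
  open import Data.List using (List; []; _∷_; _++_; map; concatMap; length; filter)
  open import Data.List.Membership.Propositional using (_∈_)
  open import Data.List.Membership.Propositional.Properties using (∈-filter⁺; ∈-filter⁻)
  import Data.List.Properties as List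
  import Data.List.Relation.Binary.Sublist.Propositional as Sublist
  import Data.List.Relation.Binary.Sublist.Propositional.Properties as Sublist
  open import Data.List.Relation.Unary.All as All using ()
  open import Data.List.Relation.Unary.Any using (here)
  open import Data.List.Relation.Unary.Any.Properties using (singleton⁻)
  open import Data.Nat as ℕ using (ℕ; zero; suc)
  open import Data.Nat.Combinatorics using (_C_; nC1≡n; nCk+nC[k+1]≡[n+1]C[k+1])
  open import Data.Nat.Coprimality using (1-coprimeTo) renaming (sym to coprime-sym)
  import Data.Nat.Properties as ℕ
  import Data.Nat.Tactic.RingSolver as ℕ-Solver
  open import Data.Product using (∃; _×_; _,_; proj₁; proj₂)
  open import Data.Rational as ℚ using (ℚ; mkℚ; Positive; ↧ₙ_)
  import Data.Rational.Properties as ℚ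
  import Data.Rational.Unnormalised as ℚᵘ
  import Data.Rational.Unnormalised.Properties as ℚᵘ
  open import Data.Unit using (tt)
  open import Data.Vec using (Vec; []; _∷_; lookup; _[_]≔_)
  open import Data.Vec.Properties using (lookup∘update; lookup∘update′)
  open import Function using (_∘_; id; case_of_)
  open import Relation.Binary.PropositionalEquality
  open import Relation.Nullary using (Dec; does; yes; no; ¬_; contradiction)
  open import Relation.Unary using (Decidable)

  𝟙 : Bool → ℤ
  𝟙 true  = 1ℤ
  𝟙 false = 0ℤ

  0≤𝟙 : ∀ b → 0ℤ ≤ 𝟙 b
  0≤𝟙 true  = +≤+ ℕ.z≤n
  0≤𝟙 false = +≤+ ℕ.z≤n

  𝟙*𝟙≤1 : ∀ b → 𝟙 b * 𝟙 b ≤ 1ℤ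
  𝟙*𝟙≤1 true  = ℤ.≤-refl
  𝟙*𝟙≤1 false = +≤+ ℕ.z≤n

  𝟙-≡0-antitone : ∀ {m k} → m ℕ.≤ k → 𝟙 (does (k ℕ.≟ 0)) ≤ 𝟙 (does (m ℕ.≟ 0))
  𝟙-≡0-antitone {k = zero}  ℕ.z≤n = ℤ.≤-refl
  𝟙-≡0-antitone {k = suc k} _     = 0≤𝟙 _

  0≤i*i : ∀ i → 0ℤ ≤ i * i
  0≤i*i (+ n)    = subst (0ℤ ≤_) (ℤ.pos-* n n) (+≤+ ℕ.z≤n)
  0≤i*i -[1+ n ] = +≤+ ℕ.z≤n

  2txy≤t²+y² : ∀ t x y → x * x ≤ 1ℤ → + 2 * t * (x * y) ≤ t * t + y * y
  2txy≤t²+y² t x y x²≤1 = begin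
    + 2 * t * (x * y)                             ≡⟨ ℤ.+-identityˡ _ ⟨
    0ℤ + + 2 * t * (x * y)                        ≤⟨ ℤ.+-monoˡ-≤ _ (0≤i*i (t * x - y)) ⟩
    (t * x - y) * (t * x - y) + + 2 * t * (x * y) ≡⟨ expand t x y ⟩
    (t * t) * (x * x) + y * y                     ≤⟨ ℤ.+-monoˡ-≤ (y * y) t²x²≤t² ⟩
    (t * t) * 1ℤ + y * y                          ≡⟨ cong (_+ y * y) (ℤ.*-identityʳ (t * t)) ⟩
    t * t + y * y                                 ∎
    where
    open ℤ.≤-Reasoning
    expand : ∀ t x y → (t * x - y) * (t * x - y) + + 2 * t * (x * y) ≡ (t * t) * (x * x) + y * y
    expand = solve-∀
    t²x²≤t² : (t * t) * (x * x) ≤ (t * t) * 1ℤ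
    t²x²≤t² = ℤ.*-monoˡ-≤-nonNeg (t * t) {{ℤ.nonNegative (0≤i*i t)}} x²≤1

  ∑ₗ : {A : Set} → List A → (A → ℤ) → ℤ
  ∑ₗ []       f = 0ℤ
  ∑ₗ (x ∷ xs) f = f x + ∑ₗ xs f

  infix 10 ∑ₗ
  syntax ∑ₗ xs (λ x → e) = ∑[ x ∈ xs ] e

  module _ {A : Set} where

    ∑ₗ-cong : ∀ (xs : List A) {f g : A → ℤ} → (∀ x → f x ≡ g x) → ∑ₗ xs f ≡ ∑ₗ xs g
    ∑ₗ-cong []       f≗g = refl
    ∑ₗ-cong (x ∷ xs) f≗g = cong₂ _+_ (f≗g x) (∑ₗ-cong xs f≗g)

    ∑ₗ-mono-≤ : ∀ (xs : List A) {f g : A → ℤ} → (∀ x → f x ≤ g x) → ∑ₗ xs f ≤ ∑ₗ xs g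
    ∑ₗ-mono-≤ []       f≤g = ℤ.≤-refl
    ∑ₗ-mono-≤ (x ∷ xs) f≤g = ℤ.+-mono-≤ (f≤g x) (∑ₗ-mono-≤ xs f≤g)

    ∑ₗ-zero : ∀ (xs : List A) → ∑[ _ ∈ xs ] 0ℤ ≡ 0ℤ
    ∑ₗ-zero []       = refl
    ∑ₗ-zero (x ∷ xs) = trans (ℤ.+-identityˡ _) (∑ₗ-zero xs)

    ∑ₗ-distrib-+ : ∀ (xs : List A) (f g : A → ℤ) →
                   ∑[ x ∈ xs ] (f x + g x) ≡ ∑ₗ xs f + ∑ₗ xs g
    ∑ₗ-distrib-+ []       f g = refl
    ∑ₗ-distrib-+ (x ∷ xs) f g = begin
      f x + g x + ∑[ x ∈ xs ] (f x + g x) ≡⟨ cong (_+_ (f x + g x)) (∑ₗ-distrib-+ xs f g) ⟩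
      f x + g x + (∑ₗ xs f + ∑ₗ xs g)     ≡⟨ shuffle (f x) (g x) (∑ₗ xs f) (∑ₗ xs g) ⟩
      f x + ∑ₗ xs f + (g x + ∑ₗ xs g)     ∎
      where
      open ≡-Reasoning
      shuffle : ∀ a b c d → a + b + (c + d) ≡ a + c + (b + d)
      shuffle = solve-∀

    *-distribˡ-∑ₗ : ∀ (xs : List A) c (f : A → ℤ) → c * ∑ₗ xs f ≡ ∑[ x ∈ xs ] (c * f x)
    *-distribˡ-∑ₗ []       c f = ℤ.*-zeroʳ c
    *-distribˡ-∑ₗ (x ∷ xs) c f =
      trans (ℤ.*-distribˡ-+ c (f x) (∑ₗ xs f)) (cong (_+_ (c * f x)) (*-distribˡ-∑ₗ xs c f))

    ∑ₗ-++ : ∀ (xs ys : List A) f → ∑ₗ (xs ++ ys) f ≡ ∑ₗ xs f + ∑ₗ ys f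
    ∑ₗ-++ []       ys f = sym (ℤ.+-identityˡ _)
    ∑ₗ-++ (x ∷ xs) ys f =
      trans (cong (_+_ (f x)) (∑ₗ-++ xs ys f)) (sym (ℤ.+-assoc (f x) (∑ₗ xs f) (∑ₗ ys f)))

    length-filter≡∑ₗ𝟙 : ∀ {P : A → Set} (P? : Decidable P) xs →
                        + length (filter P? xs) ≡ ∑[ x ∈ xs ] 𝟙 (does (P? x))
    length-filter≡∑ₗ𝟙 P? []       = refl
    length-filter≡∑ₗ𝟙 P? (x ∷ xs) with does (P? x)
    ... | true  = trans (ℤ.pos-+ 1 _) (cong (_+_ 1ℤ) (length-filter≡∑ₗ𝟙 P? xs))
    ... | false = trans (length-filter≡∑ₗ𝟙 P? xs) (sym (ℤ.+-identityˡ _))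

  ∑ₗ-map : ∀ {A B : Set} (h : A → B) xs (f : B → ℤ) → ∑ₗ (map h xs) f ≡ ∑ₗ xs (f ∘ h)
  ∑ₗ-map h []       f = refl
  ∑ₗ-map h (x ∷ xs) f = cong (_+_ (f (h x))) (∑ₗ-map h xs f)

  ∑ₗ-concatMap : ∀ {A B : Set} (h : A → List B) xs (f : B → ℤ) →
                 ∑ₗ (concatMap h xs) f ≡ ∑[ x ∈ xs ] ∑ₗ (h x) f
  ∑ₗ-concatMap h []       f = refl
  ∑ₗ-concatMap h (x ∷ xs) f =
    trans (∑ₗ-++ (h x) (concatMap h xs) f) (cong (_+_ (∑ₗ (h x) f)) (∑ₗ-concatMap h xs f))

  ∑ₗ-comm : ∀ {A B : Set} (xs : List A) (ys : List B) (f : A → B → ℤ) →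
            ∑[ x ∈ xs ] ∑[ y ∈ ys ] f x y ≡ ∑[ y ∈ ys ] ∑[ x ∈ xs ] f x y
  ∑ₗ-comm []       ys f = sym (∑ₗ-zero ys)
  ∑ₗ-comm (x ∷ xs) ys f = trans (cong (_+_ (∑ₗ ys (f x))) (∑ₗ-comm xs ys f))
                                (sym (∑ₗ-distrib-+ ys (f x) _))

  ∑ₗ∑ₗ-distrib-+ : ∀ {A B : Set} (xs : List A) (ys : List B) (f g : A → B → ℤ) →
                   ∑[ x ∈ xs ] ∑[ y ∈ ys ] (f x y + g x y)
                     ≡ ∑[ x ∈ xs ] ∑[ y ∈ ys ] f x y + ∑[ x ∈ xs ] ∑[ y ∈ ys ] g x y
  ∑ₗ∑ₗ-distrib-+ xs ys f g =
    trans (∑ₗ-cong xs λ x → ∑ₗ-distrib-+ ys (f x) (g x)) (∑ₗ-distrib-+ xs _ _)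

  ∑ₗ-const : ∀ {A : Set} (xs : List A) c → ∑[ _ ∈ xs ] c ≡ c * ∑[ _ ∈ xs ] 1ℤ
  ∑ₗ-const xs c = trans (∑ₗ-cong xs λ _ → sym (ℤ.*-identityʳ c)) (sym (*-distribˡ-∑ₗ xs c _))

  ∑ₗ-square-of-sum : ∀ {A B : Set} (xs : List A) (ys : List B) (a : A → ℤ) (b : B → ℤ) →
                     ∑ₗ ys b ≡ 0ℤ →
                     ∑[ x ∈ xs ] ∑[ y ∈ ys ] ((b y + a x) * (b y + a x))
                       ≡ (∑[ _ ∈ ys ] 1ℤ) * ∑[ x ∈ xs ] (a x * a x)
                         + (∑[ _ ∈ xs ] 1ℤ) * ∑[ y ∈ ys ] (b y * b y)
  ∑ₗ-square-of-sum xs ys a b ∑b≡0 = begin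
    ∑[ x ∈ xs ] ∑[ y ∈ ys ] ((b y + a x) * (b y + a x))
      ≡⟨ ∑ₗ-cong xs inner ⟩
    ∑[ x ∈ xs ] (Y * (a x * a x) + ∑b²)
      ≡⟨ ∑ₗ-distrib-+ xs _ _ ⟩
    ∑[ x ∈ xs ] (Y * (a x * a x)) + ∑[ _ ∈ xs ] ∑b²
      ≡⟨ cong₂ _+_ (sym (*-distribˡ-∑ₗ xs Y _)) (∑ₗ-const xs ∑b²) ⟩
    Y * ∑[ x ∈ xs ] (a x * a x) + ∑b² * X
      ≡⟨ cong (_+_ (Y * ∑[ x ∈ xs ] (a x * a x))) (ℤ.*-comm ∑b² X) ⟩
    Y * ∑[ x ∈ xs ] (a x * a x) + X * ∑b²
      ∎
    where
    open ≡-Reasoning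
    X = ∑[ _ ∈ xs ] 1ℤ
    Y = ∑[ _ ∈ ys ] 1ℤ
    ∑b² = ∑[ y ∈ ys ] (b y * b y)
    expand : ∀ β α → (β + α) * (β + α) ≡ α * α * 1ℤ + + 2 * α * β + β * β
    expand = solve-∀
    collect : ∀ α Y B → α * α * Y + + 2 * α * 0ℤ + B ≡ Y * (α * α) + B
    collect = solve-∀
    inner : ∀ x → ∑[ y ∈ ys ] ((b y + a x) * (b y + a x)) ≡ Y * (a x * a x) + ∑b²
    inner x = let α = a x in begin
      ∑[ y ∈ ys ] ((b y + α) * (b y + α))
        ≡⟨ ∑ₗ-cong ys (λ y → expand (b y) α) ⟩
      ∑[ y ∈ ys ] (α * α * 1ℤ + + 2 * α * b y + b y * b y)
        ≡⟨ trans (∑ₗ-distrib-+ ys _ _) (cong (_+ ∑b²) (∑ₗ-distrib-+ ys _ _)) ⟩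
      ∑[ y ∈ ys ] (α * α * 1ℤ) + ∑[ y ∈ ys ] (+ 2 * α * b y) + ∑b²
        ≡⟨ cong (_+ ∑b²) (cong₂ _+_ (*-distribˡ-∑ₗ ys (α * α) _) (*-distribˡ-∑ₗ ys (+ 2 * α) b)) ⟨
      α * α * Y + + 2 * α * ∑ₗ ys b + ∑b²
        ≡⟨ cong (λ s → α * α * Y + + 2 * α * s + ∑b²) ∑b≡0 ⟩
      α * α * Y + + 2 * α * 0ℤ + ∑b²
        ≡⟨ collect α Y ∑b² ⟩
      Y * (α * α) + ∑b²
        ∎

  -- A Leibniz rule for difference operators; it carries ∑-risesᵛ and ∑-rises through the product
  -- decompositions of Vec Bool (suc k) and Graph (suc n).
  ∑ₗ-product-rule : ∀ {X Y : Set} (xs : List X) (ys : List Y)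
                    (ρX : (X → ℤ) → X → ℤ) (a : X → ℤ) (ρY : (Y → ℤ) → Y → ℤ) (b : Y → ℤ) →
                    (∀ g → ∑ₗ xs (ρX g) ≡ ∑[ x ∈ xs ] (g x * a x)) →
                    (∀ h → ∑ₗ ys (ρY h) ≡ ∑[ y ∈ ys ] (h y * b y)) →
                    ∀ (f : X → Y → ℤ) →
                    ∑[ x ∈ xs ] ∑[ y ∈ ys ] (ρY (f x) y + ρX (λ x′ → f x′ y) x)
                      ≡ ∑[ x ∈ xs ] ∑[ y ∈ ys ] (f x y * (b y + a x))
  ∑ₗ-product-rule xs ys ρX a ρY b ∑ρX ∑ρY f = begin
    ∑[ x ∈ xs ] ∑[ y ∈ ys ] (ρY (f x) y + ρX (λ x′ → f x′ y) x)
      ≡⟨ ∑ₗ∑ₗ-distrib-+ xs ys _ _ ⟩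
    ∑[ x ∈ xs ] ∑[ y ∈ ys ] ρY (f x) y + ∑[ x ∈ xs ] ∑[ y ∈ ys ] ρX (λ x′ → f x′ y) x
      ≡⟨ cong₂ _+_ (∑ₗ-cong xs λ x → ∑ρY (f x)) (∑ₗ-comm xs ys _) ⟩
    ∑[ x ∈ xs ] ∑[ y ∈ ys ] (f x y * b y) + ∑[ y ∈ ys ] ∑[ x ∈ xs ] ρX (λ x′ → f x′ y) x
      ≡⟨ cong (_+_ (∑[ x ∈ xs ] ∑[ y ∈ ys ] (f x y * b y))) (∑ₗ-cong ys λ y → ∑ρX (λ x′ → f x′ y)) ⟩
    ∑[ x ∈ xs ] ∑[ y ∈ ys ] (f x y * b y) + ∑[ y ∈ ys ] ∑[ x ∈ xs ] (f x y * a x)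
      ≡⟨ cong (_+_ (∑[ x ∈ xs ] ∑[ y ∈ ys ] (f x y * b y))) (∑ₗ-comm ys xs _) ⟩
    ∑[ x ∈ xs ] ∑[ y ∈ ys ] (f x y * b y) + ∑[ x ∈ xs ] ∑[ y ∈ ys ] (f x y * a x)
      ≡⟨ ∑ₗ∑ₗ-distrib-+ xs ys _ _ ⟨
    ∑[ x ∈ xs ] ∑[ y ∈ ys ] (f x y * b y + f x y * a x)
      ≡⟨ ∑ₗ-cong xs (λ x → ∑ₗ-cong ys λ y → sym (ℤ.*-distribˡ-+ (f x y) (b y) (a x))) ⟩
    ∑[ x ∈ xs ] ∑[ y ∈ ys ] (f x y * (b y + a x))
      ∎
    where open ≡-Reasoning

  ∑ₗ-cross-≤ : ∀ {A : Set} (xs : List A) (f a : A → ℤ) t → (∀ x → f x * f x ≤ 1ℤ) →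
               + 2 * t * ∑[ x ∈ xs ] (f x * a x) ≤ t * t * ∑[ _ ∈ xs ] 1ℤ + ∑[ x ∈ xs ] (a x * a x)
  ∑ₗ-cross-≤ xs f a t f²≤1 = begin
    + 2 * t * ∑[ x ∈ xs ] (f x * a x)               ≡⟨ *-distribˡ-∑ₗ xs (+ 2 * t) _ ⟩
    ∑[ x ∈ xs ] (+ 2 * t * (f x * a x))             ≤⟨ ∑ₗ-mono-≤ xs (λ x → 2txy≤t²+y² t (f x) (a x) (f²≤1 x)) ⟩
    ∑[ x ∈ xs ] (t * t + a x * a x)                 ≡⟨ ∑ₗ-distrib-+ xs _ _ ⟩
    ∑[ _ ∈ xs ] (t * t) + ∑[ x ∈ xs ] (a x * a x)   ≡⟨ cong (_+ ∑[ x ∈ xs ] (a x * a x)) (∑ₗ-const xs (t * t)) ⟩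
    t * t * ∑[ _ ∈ xs ] 1ℤ + ∑[ x ∈ xs ] (a x * a x) ∎
    where open ℤ.≤-Reasoning

  module _ {A : Set} {P : A → Set} (P? : Decidable P) where

    length-filter-mono : ∀ {Q : A → Set} (Q? : Decidable Q) → (∀ {x} → P x → Q x) →
                         ∀ xs → length (filter P? xs) ℕ.≤ length (filter Q? xs)
    length-filter-mono Q? P⇒Q xs =
      Sublist.length-mono-≤ (Sublist.filter⁺ P? Q? (λ { refl → P⇒Q }) (Sublist.⊆-refl {x = xs}))

    length-filter≡0 : ∀ {xs} → (∀ {x} → x ∈ xs → ¬ P x) → length (filter P? xs) ≡ 0
    length-filter≡0 ¬P = cong length (List.filter-none P? (All.tabulate ¬P))

    length-filter≡1⇒unique : ∀ xs → length (filter P? xs) ≡ 1 →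
                             ∃ λ x → P x × (∀ {y} → y ∈ xs → P y → y ≡ x)
    length-filter≡1⇒unique xs _ with filter P? xs in filter≡[x]
    ... | x ∷ [] = x , Px , λ y∈xs Py → singleton⁻ (subst (_ ∈_) filter≡[x] (∈-filter⁺ P? y∈xs Py))
      where Px = proj₂ (∈-filter⁻ P? {xs = xs} (subst (x ∈_) (sym filter≡[x]) (here refl)))

  ∑-mono-≤ : ∀ {n} {f g : Fin n → ℤ} → (∀ i → f i ≤ g i) → sum f ≤ sum g
  ∑-mono-≤ {zero}  f≤g = ℤ.≤-refl
  ∑-mono-≤ {suc n} f≤g = ℤ.+-mono-≤ (f≤g zero) (∑-mono-≤ (f≤g ∘ suc))

  ∑-nonNeg : ∀ {n} {f : Fin n → ℤ} → (∀ i → 0ℤ ≤ f i) → 0ℤ ≤ sum f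
  ∑-nonNeg {zero}  0≤f = ℤ.≤-refl
  ∑-nonNeg {suc n} 0≤f = ℤ.+-mono-≤ (0≤f zero) (∑-nonNeg (0≤f ∘ suc))

  ∑-const : ∀ n c → ∑[ i < n ] c ≡ + n * c
  ∑-const zero    c = sym (ℤ.*-zeroˡ c)
  ∑-const (suc n) c = begin
    c + ∑[ i < n ] c ≡⟨ cong (_+_ c) (∑-const n c) ⟩
    c + + n * c      ≡⟨ cong (_+ + n * c) (ℤ.*-identityˡ c) ⟨
    1ℤ * c + + n * c ≡⟨ ℤ.*-distribʳ-+ c 1ℤ (+ n) ⟨
    + suc n * c      ∎
    where open ≡-Reasoning

  ∑∑-distrib-+ : ∀ {m n} (f g : Fin m → Fin n → ℤ) →
                 ∑[ i < m ] ∑[ j < n ] (f i j + g i j)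
                   ≡ ∑[ i < m ] ∑[ j < n ] f i j + ∑[ i < m ] ∑[ j < n ] g i j
  ∑∑-distrib-+ {n = n} f g =
    trans (sum-cong-≗ λ i → ∑-distrib-+ (f i) (g i)) (∑-distrib-+ (λ i → ∑[ j < n ] f i j) _)

  ∑-𝟙-≟ : ∀ {n} (u : Fin n) → ∑[ v < n ] 𝟙 (does (u ≟ᶠ v)) ≡ 1ℤ
  ∑-𝟙-≟ {suc n} zero    = cong (_+_ 1ℤ) (trans (∑-const n 0ℤ) (ℤ.*-zeroʳ (+ n)))
  ∑-𝟙-≟ {suc n} (suc u) = trans (ℤ.+-identityˡ _) (∑-𝟙-≟ u)

  ∑∑-1 : ∀ n → ∑[ u < n ] ∑[ v < n ] 1ℤ ≡ + n * + n
  ∑∑-1 n = begin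
    ∑[ u < n ] ∑[ v < n ] 1ℤ  ≡⟨ sum-cong-≗ {n} {λ _ → ∑[ v < n ] 1ℤ} (λ _ → ∑-const n 1ℤ) ⟩
    ∑[ u < n ] (+ n * 1ℤ)     ≡⟨ ∑-const n (+ n * 1ℤ) ⟩
    + n * (+ n * 1ℤ)          ≡⟨ cong (+ n *_) (ℤ.*-identityʳ (+ n)) ⟩
    + n * + n                 ∎
    where open ≡-Reasoning

  ∑∑-𝟙-≟ : ∀ {n} → ∑[ u < n ] ∑[ v < n ] 𝟙 (does (u ≟ᶠ v)) ≡ + n
  ∑∑-𝟙-≟ {n} = begin
    ∑[ u < n ] ∑[ v < n ] 𝟙 (does (u ≟ᶠ v)) ≡⟨ sum-cong-≗ {n} {λ u → ∑[ v < n ] 𝟙 (does (u ≟ᶠ v))} ∑-𝟙-≟ ⟩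
    ∑[ u < n ] 1ℤ                           ≡⟨ ∑-const n 1ℤ ⟩
    + n * 1ℤ                                ≡⟨ ℤ.*-identityʳ (+ n) ⟩
    + n                                     ∎
    where open ≡-Reasoning

  ∑-𝟙-lookup : ∀ {k} (w : Vec Bool k) → ∑[ j < k ] 𝟙 (lookup w j) ≡ + trues w
  ∑-𝟙-lookup []          = refl
  ∑-𝟙-lookup (true ∷ w)  = trans (cong (_+_ 1ℤ) (∑-𝟙-lookup w)) (sym (ℤ.pos-+ 1 (trues w)))
  ∑-𝟙-lookup (false ∷ w) = cong (_+_ 0ℤ) (∑-𝟙-lookup w)

  ∑-injective-≤ : ∀ {m n} (φ : Fin m → Fin n) → (∀ {i j} → φ i ≡ φ j → i ≡ j) →
                  {h : Fin n → ℤ} → (∀ j → 0ℤ ≤ h j) → ∑[ i < m ] h (φ i) ≤ ∑[ j < n ] h j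
  ∑-injective-≤ {zero}          φ φ-inj     0≤h = ∑-nonNeg 0≤h
  ∑-injective-≤ {suc m} {zero}  φ φ-inj     0≤h with () ← φ zero
  ∑-injective-≤ {suc m} {suc n} φ φ-inj {h} 0≤h = begin
    h φ₀ + ∑[ i < m ] h (φ (suc i))
      ≡⟨ cong (_+_ (h φ₀)) (sum-cong-≗ λ i → cong h (punchIn-punchOut (φ₀≢ i))) ⟨
    h φ₀ + ∑[ i < m ] h (punchIn φ₀ (φ′ i))
      ≤⟨ ℤ.+-monoʳ-≤ (h φ₀) (∑-injective-≤ φ′ φ′-inj (0≤h ∘ punchIn φ₀)) ⟩
    h φ₀ + ∑[ j < n ] h (punchIn φ₀ j)
      ≡⟨ sum-remove h ⟨
    ∑[ j < suc n ] h j
      ∎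
    where
    open ℤ.≤-Reasoning
    φ₀ = φ zero
    φ₀≢ : ∀ i → φ₀ ≢ φ (suc i)
    φ₀≢ i eq with () ← φ-inj eq
    φ′ : Fin m → Fin n
    φ′ i = punchOut (φ₀≢ i)
    φ′-inj : ∀ {i j} → φ′ i ≡ φ′ j → i ≡ j
    φ′-inj eq = suc-injective (φ-inj (punchOut-injective (φ₀≢ _) (φ₀≢ _) eq))

  choose2 : ℕ → ℕ
  choose2 zero    = 0
  choose2 (suc n) = choose2 n ℕ.+ n

  choose2≡nC2 : ∀ n → choose2 n ≡ n C 2
  choose2≡nC2 zero    = refl
  choose2≡nC2 (suc n) = begin
    choose2 n ℕ.+ n   ≡⟨ cong₂ ℕ._+_ (choose2≡nC2 n) (sym (nC1≡n n)) ⟩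
    n C 2 ℕ.+ n C 1   ≡⟨ ℕ.+-comm (n C 2) (n C 1) ⟩
    n C 1 ℕ.+ n C 2   ≡⟨ nCk+nC[k+1]≡[n+1]C[k+1] n 1 ⟩
    suc n C 2         ∎
    where open ≡-Reasoning

  2*choose2+n≡n*n : ∀ n → 2 ℕ.* choose2 n ℕ.+ n ≡ n ℕ.* n
  2*choose2+n≡n*n zero    = refl
  2*choose2+n≡n*n (suc n) = begin
    2 ℕ.* (choose2 n ℕ.+ n) ℕ.+ suc n            ≡⟨ regroup (choose2 n) n ⟩
    (2 ℕ.* choose2 n ℕ.+ n) ℕ.+ (1 ℕ.+ 2 ℕ.* n) ≡⟨ cong (ℕ._+ (1 ℕ.+ 2 ℕ.* n)) (2*choose2+n≡n*n n) ⟩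
    n ℕ.* n ℕ.+ (1 ℕ.+ 2 ℕ.* n)                 ≡⟨ square n ⟩
    suc n ℕ.* suc n                              ∎
    where
    open ≡-Reasoning
    regroup : ∀ N n → 2 ℕ.* (N ℕ.+ n) ℕ.+ suc n ≡ (2 ℕ.* N ℕ.+ n) ℕ.+ (1 ℕ.+ 2 ℕ.* n)
    regroup = ℕ-Solver.solve-∀
    square : ∀ n → n ℕ.* n ℕ.+ (1 ℕ.+ 2 ℕ.* n) ≡ suc n ℕ.* suc n
    square = ℕ-Solver.solve-∀

  n*n≡2*choose2+n : ∀ n → + n * + n ≡ + 2 * + choose2 n + + n
  n*n≡2*choose2+n n = begin
    + n * + n                  ≡⟨ ℤ.pos-* n n ⟨
    + (n ℕ.* n)                ≡⟨ cong +_ (2*choose2+n≡n*n n) ⟨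
    + (2 ℕ.* choose2 n ℕ.+ n)  ≡⟨ ℤ.pos-+ (2 ℕ.* choose2 n) n ⟩
    + (2 ℕ.* choose2 n) + + n  ≡⟨ cong (_+ + n) (ℤ.pos-* 2 (choose2 n)) ⟩
    + 2 * + choose2 n + + n    ∎
    where open ≡-Reasoning

  2^choose2-suc : ∀ n → + (2 ℕ.^ choose2 (suc n)) ≡ + (2 ℕ.^ choose2 n) * + (2 ℕ.^ n)
  2^choose2-suc n = trans (cong +_ (ℕ.^-distribˡ-+-* 2 (choose2 n) n)) (ℤ.pos-* (2 ℕ.^ choose2 n) (2 ℕ.^ n))

  addEdge : ∀ {n} → Graph n → Fin n → Fin n → Graph n
  addEdge {suc n} (G , w) zero    zero    = G , w
  addEdge {suc n} (G , w) zero    (suc j) = G , w [ j ]≔ true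
  addEdge {suc n} (G , w) (suc i) zero    = G , w [ i ]≔ true
  addEdge {suc n} (G , w) (suc i) (suc j) = addEdge G i j , w

  infix 4 _⊆_
  _⊆_ : ∀ {n} → Graph n → Graph n → Set
  G ⊆ G′ = ∀ x y → x ~ y within G → x ~ y within G′

  ⊆-refl : ∀ {n} {G : Graph n} → G ⊆ G
  ⊆-refl _ _ = id

  ⊆-extend : ∀ {n} {G G′ : Graph n} {w w′ : Vec Bool n} →
             G ⊆ G′ → (∀ j → lookup w j ≡ true → lookup w′ j ≡ true) → (G , w) ⊆ (G′ , w′)
  ⊆-extend G⊆G′ w≤w′ zero    zero    ()
  ⊆-extend G⊆G′ w≤w′ zero    (suc j) = w≤w′ j
  ⊆-extend G⊆G′ w≤w′ (suc i) zero    = w≤w′ i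
  ⊆-extend G⊆G′ w≤w′ (suc i) (suc j) = G⊆G′ i j

  lookup-[]≔true : ∀ {k} (w : Vec Bool k) i j → lookup w j ≡ true → lookup (w [ i ]≔ true) j ≡ true
  lookup-[]≔true w i j wⱼ with j ≟ᶠ i
  ... | yes refl = lookup∘update j w true
  ... | no  j≢i  = trans (lookup∘update′ j≢i w true) wⱼ

  ⊆-addEdge : ∀ {n} (G : Graph n) u v → G ⊆ addEdge G u v
  ⊆-addEdge {suc n} (G , w) zero    zero    = ⊆-refl
  ⊆-addEdge {suc n} (G , w) zero    (suc j) = ⊆-extend ⊆-refl (lookup-[]≔true w j)
  ⊆-addEdge {suc n} (G , w) (suc i) zero    = ⊆-extend ⊆-refl (lookup-[]≔true w i)
  ⊆-addEdge {suc n} (G , w) (suc i) (suc j) = ⊆-extend (⊆-addEdge G i j) (λ _ → id)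

  addEdge-adj : ∀ {n} (G : Graph n) {u v} → u ≢ v → u ~ v within addEdge G u v
  addEdge-adj {suc n} (G , w) {zero}  {zero}  u≢v = contradiction refl u≢v
  addEdge-adj {suc n} (G , w) {zero}  {suc j} u≢v = lookup∘update j w true
  addEdge-adj {suc n} (G , w) {suc i} {zero}  u≢v = lookup∘update i w true
  addEdge-adj {suc n} (G , w) {suc i} {suc j} u≢v = addEdge-adj G (u≢v ∘ cong suc)

  ∑∑-adj : ∀ {n} (H : Graph n) → ∑[ a < n ] ∑[ b < n ] 𝟙 (adj H a b) ≡ + 2 * + e H
  ∑∑-adj {zero}  H       = refl
  ∑∑-adj {suc n} (H , w) = begin
    ∑[ a < suc n ] ∑[ b < suc n ] 𝟙 (adj (H , w) a b)
      ≡⟨⟩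
    (0ℤ + ∑[ j < n ] 𝟙 (lookup w j)) + ∑[ i < n ] (𝟙 (lookup w i) + ∑[ j < n ] 𝟙 (adj H i j))
      ≡⟨ cong (_+_ (0ℤ + ∑[ j < n ] 𝟙 (lookup w j))) (∑-distrib-+ (λ i → 𝟙 (lookup w i)) _) ⟩
    (0ℤ + ∑[ j < n ] 𝟙 (lookup w j)) + (∑[ i < n ] 𝟙 (lookup w i) + ∑[ i < n ] ∑[ j < n ] 𝟙 (adj H i j))
      ≡⟨ cong₂ (λ t s → (0ℤ + t) + (t + s)) (∑-𝟙-lookup w) (∑∑-adj H) ⟩
    (0ℤ + + trues w) + (+ trues w + + 2 * + e H)
      ≡⟨ collect (+ trues w) (+ e H) ⟩
    + 2 * (+ e H + + trues w)
      ≡⟨ cong (+ 2 *_) (ℤ.pos-+ (e H) (trues w)) ⟨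
    + 2 * + (e H ℕ.+ trues w)
      ∎
    where
    open ≡-Reasoning
    collect : ∀ t m → (0ℤ + t) + (t + + 2 * m) ≡ + 2 * (m + t)
    collect = solve-∀

  ∑∑-adj-injective-≤ : ∀ {n} (H : Graph n) {φ : Fin n → Fin n} → (∀ {i j} → φ i ≡ φ j → i ≡ j) →
                       ∑[ u < n ] ∑[ v < n ] 𝟙 (adj H (φ u) (φ v)) ≤ + 2 * + e H
  ∑∑-adj-injective-≤ {n} H {φ} φ-inj = begin
    ∑[ u < n ] ∑[ v < n ] 𝟙 (adj H (φ u) (φ v))
      ≤⟨ ∑-mono-≤ (λ u → ∑-injective-≤ φ φ-inj (λ b → 0≤𝟙 (adj H (φ u) b))) ⟩
    ∑[ u < n ] ∑[ b < n ] 𝟙 (adj H (φ u) b)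
      ≤⟨ ∑-injective-≤ φ φ-inj (λ a → ∑-nonNeg λ b → 0≤𝟙 (adj H a b)) ⟩
    ∑[ a < n ] ∑[ b < n ] 𝟙 (adj H a b)
      ≡⟨ ∑∑-adj H ⟩
    + 2 * + e H
      ∎
    where open ℤ.≤-Reasoning

  bits : List Bool
  bits = false ∷ true ∷ []

  ∑-allBoolVecs-suc : ∀ k (g : Vec Bool (suc k) → ℤ) →
                      ∑ₗ (allBoolVecs (suc k)) g ≡ ∑[ w ∈ allBoolVecs k ] ∑[ b ∈ bits ] g (b ∷ w)
  ∑-allBoolVecs-suc k g = ∑ₗ-concatMap _ (allBoolVecs k) g

  ∑-allGraphs-suc : ∀ n (f : Graph (suc n) → ℤ) →
                    ∑ₗ (allGraphs (suc n)) f ≡ ∑[ G ∈ allGraphs n ] ∑[ w ∈ allBoolVecs n ] f (G , w)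
  ∑-allGraphs-suc n f =
    trans (∑ₗ-concatMap _ (allGraphs n) f) (∑ₗ-cong (allGraphs n) λ G → ∑ₗ-map _ (allBoolVecs n) f)

  ∑-allBoolVecs-1 : ∀ k → ∑[ _ ∈ allBoolVecs k ] 1ℤ ≡ + (2 ℕ.^ k)
  ∑-allBoolVecs-1 zero    = refl
  ∑-allBoolVecs-1 (suc k) = begin
    ∑ₗ (allBoolVecs (suc k)) (λ _ → 1ℤ)     ≡⟨ ∑-allBoolVecs-suc k _ ⟩
    ∑[ _ ∈ allBoolVecs k ] (1ℤ + (1ℤ + 0ℤ)) ≡⟨ ∑ₗ-const (allBoolVecs k) (+ 2) ⟩
    + 2 * ∑[ _ ∈ allBoolVecs k ] 1ℤ         ≡⟨ cong (+ 2 *_) (∑-allBoolVecs-1 k) ⟩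
    + 2 * + (2 ℕ.^ k)                       ≡⟨ ℤ.pos-* 2 (2 ℕ.^ k) ⟨
    + (2 ℕ.^ suc k)                         ∎
    where open ≡-Reasoning

  ∑-allGraphs-1 : ∀ n → ∑[ _ ∈ allGraphs n ] 1ℤ ≡ + (2 ℕ.^ choose2 n)
  ∑-allGraphs-1 zero    = refl
  ∑-allGraphs-1 (suc n) = begin
    ∑ₗ (allGraphs (suc n)) (λ _ → 1ℤ)               ≡⟨ ∑-allGraphs-suc n _ ⟩
    ∑[ _ ∈ allGraphs n ] ∑[ _ ∈ allBoolVecs n ] 1ℤ  ≡⟨ ∑ₗ-cong (allGraphs n) (λ _ → ∑-allBoolVecs-1 n) ⟩
    ∑[ _ ∈ allGraphs n ] (+ (2 ℕ.^ n))              ≡⟨ ∑ₗ-const (allGraphs n) _ ⟩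
    + (2 ℕ.^ n) * ∑[ _ ∈ allGraphs n ] 1ℤ           ≡⟨ cong (+ (2 ℕ.^ n) *_) (∑-allGraphs-1 n) ⟩
    + (2 ℕ.^ n) * + (2 ℕ.^ choose2 n)               ≡⟨ ℤ.*-comm (+ (2 ℕ.^ n)) _ ⟩
    + (2 ℕ.^ choose2 n) * + (2 ℕ.^ n)               ≡⟨ 2^choose2-suc n ⟨
    + (2 ℕ.^ choose2 (suc n))                       ∎
    where open ≡-Reasoning

  spin : Bool → ℤ
  spin false = -1ℤ
  spin true  = 1ℤ

  excess : ∀ {k} → Vec Bool k → ℤ
  excess []      = 0ℤ
  excess (b ∷ w) = spin b + excess w

  -- edgeExcess G = 2 e(G) - C(n,2), the number of edges minus the number of non-edges.
  edgeExcess : ∀ {n} → Graph n → ℤ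
  edgeExcess {zero}  _       = 0ℤ
  edgeExcess {suc n} (G , w) = excess w + edgeExcess G

  ∑-excess : ∀ k → ∑ₗ (allBoolVecs k) excess ≡ 0ℤ
  ∑-excess zero    = refl
  ∑-excess (suc k) = begin
    ∑ₗ (allBoolVecs (suc k)) excess
      ≡⟨ ∑-allBoolVecs-suc k excess ⟩
    ∑[ w ∈ allBoolVecs k ] (-1ℤ + excess w + (1ℤ + excess w + 0ℤ))
      ≡⟨ ∑ₗ-cong (allBoolVecs k) (λ w → twice (excess w)) ⟩
    ∑[ w ∈ allBoolVecs k ] (+ 2 * excess w)
      ≡⟨ *-distribˡ-∑ₗ (allBoolVecs k) (+ 2) excess ⟨
    + 2 * ∑ₗ (allBoolVecs k) excess
      ≡⟨ cong (+ 2 *_) (∑-excess k) ⟩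
    0ℤ
      ∎
    where
    open ≡-Reasoning
    twice : ∀ x → -1ℤ + x + (1ℤ + x + 0ℤ) ≡ + 2 * x
    twice = solve-∀

  ∑-excess² : ∀ k → ∑[ w ∈ allBoolVecs k ] (excess w * excess w) ≡ + k * + (2 ℕ.^ k)
  ∑-excess² zero    = refl
  ∑-excess² (suc k) = begin
    ∑ₗ (allBoolVecs (suc k)) (λ w → excess w * excess w)
      ≡⟨ ∑-allBoolVecs-suc k _ ⟩
    ∑[ w ∈ allBoolVecs k ] ∑[ b ∈ bits ] ((spin b + excess w) * (spin b + excess w))
      ≡⟨ ∑ₗ-square-of-sum (allBoolVecs k) bits excess spin refl ⟩
    + 2 * ∑[ w ∈ allBoolVecs k ] (excess w * excess w) + (∑[ _ ∈ allBoolVecs k ] 1ℤ) * + 2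
      ≡⟨ cong₂ (λ s t → + 2 * s + t * + 2) (∑-excess² k) (∑-allBoolVecs-1 k) ⟩
    + 2 * (+ k * + (2 ℕ.^ k)) + + (2 ℕ.^ k) * + 2
      ≡⟨ regroup (+ k) (+ (2 ℕ.^ k)) ⟩
    (1ℤ + + k) * (+ 2 * + (2 ℕ.^ k))
      ≡⟨ cong₂ _*_ (ℤ.pos-+ 1 k) (ℤ.pos-* 2 (2 ℕ.^ k)) ⟨
    + suc k * + (2 ℕ.^ suc k)
      ∎
    where
    open ≡-Reasoning
    regroup : ∀ k p → + 2 * (k * p) + p * + 2 ≡ (1ℤ + k) * (+ 2 * p)
    regroup = solve-∀

  ∑-edgeExcess² : ∀ n → ∑[ G ∈ allGraphs n ] (edgeExcess G * edgeExcess G) ≡ + choose2 n * + (2 ℕ.^ choose2 n)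
  ∑-edgeExcess² zero    = refl
  ∑-edgeExcess² (suc n) = begin
    ∑ₗ (allGraphs (suc n)) (λ G → edgeExcess G * edgeExcess G)
      ≡⟨ ∑-allGraphs-suc n _ ⟩
    ∑[ G ∈ allGraphs n ] ∑[ w ∈ allBoolVecs n ] ((excess w + edgeExcess G) * (excess w + edgeExcess G))
      ≡⟨ ∑ₗ-square-of-sum (allGraphs n) (allBoolVecs n) edgeExcess excess (∑-excess n) ⟩
    (∑[ _ ∈ allBoolVecs n ] 1ℤ) * ∑[ G ∈ allGraphs n ] (edgeExcess G * edgeExcess G)
      + (∑[ _ ∈ allGraphs n ] 1ℤ) * ∑[ w ∈ allBoolVecs n ] (excess w * excess w)
      ≡⟨ cong₂ _+_ (cong₂ _*_ (∑-allBoolVecs-1 n) (∑-edgeExcess² n)) (cong₂ _*_ (∑-allGraphs-1 n) (∑-excess² n)) ⟩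
    P * (+ choose2 n * Q) + Q * (+ n * P)
      ≡⟨ regroup P Q (+ choose2 n) (+ n) ⟩
    (+ choose2 n + + n) * (Q * P)
      ≡⟨ cong₂ _*_ (ℤ.pos-+ (choose2 n) n) (2^choose2-suc n) ⟨
    + choose2 (suc n) * + (2 ℕ.^ choose2 (suc n))
      ∎
    where
    open ≡-Reasoning
    P = + (2 ℕ.^ n)
    Q = + (2 ℕ.^ choose2 n)
    regroup : ∀ P Q N n → P * (N * Q) + Q * (n * P) ≡ (N + n) * (Q * P)
    regroup = solve-∀

  risesᵛ : ∀ {k} → (Vec Bool k → ℤ) → Vec Bool k → ℤ
  risesᵛ {k} g w = ∑[ j < k ] (g (w [ j ]≔ true) - g w)

  ∑-risesᵛ : ∀ k (g : Vec Bool k → ℤ) →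
             ∑ₗ (allBoolVecs k) (risesᵛ g) ≡ ∑[ w ∈ allBoolVecs k ] (g w * excess w)
  ∑-risesᵛ zero    g = cong (_+ 0ℤ) (sym (ℤ.*-zeroʳ (g [])))
  ∑-risesᵛ (suc k) g = begin
    ∑ₗ (allBoolVecs (suc k)) (risesᵛ g)
      ≡⟨ ∑-allBoolVecs-suc k _ ⟩
    ∑[ w ∈ allBoolVecs k ] ∑[ b ∈ bits ] (g (true ∷ w) - g (b ∷ w) + risesᵛ (λ w′ → g (b ∷ w′)) w)
      ≡⟨ ∑ₗ-product-rule (allBoolVecs k) bits risesᵛ excess (λ h b → h true - h b) spin
                         (∑-risesᵛ k) ∑-rise-bit (λ w b → g (b ∷ w)) ⟩
    ∑[ w ∈ allBoolVecs k ] ∑[ b ∈ bits ] (g (b ∷ w) * (spin b + excess w))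
      ≡⟨ ∑-allBoolVecs-suc k _ ⟨
    ∑[ w ∈ allBoolVecs (suc k) ] (g w * excess w)
      ∎
    where
    open ≡-Reasoning
    ∑-rise-bit : ∀ h → ∑[ b ∈ bits ] (h true - h b) ≡ ∑[ b ∈ bits ] (h b * spin b)
    ∑-rise-bit h = expand (h false) (h true)
      where
      expand : ∀ x y → y - x + (y - y + 0ℤ) ≡ x * -1ℤ + (y * 1ℤ + 0ℤ)
      expand = solve-∀

  rises : ∀ {n} → (Graph n → ℤ) → Graph n → ℤ
  rises {n} f G = ∑[ u < n ] ∑[ v < n ] (f (addEdge G u v) - f G)

  rises-suc : ∀ {n} (f : Graph (suc n) → ℤ) G w →
              rises f (G , w) ≡ + 2 * risesᵛ (λ w′ → f (G , w′)) w + rises (λ G′ → f (G′ , w)) G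
  rises-suc {n} f G w = begin
    rises f (G , w)
      ≡⟨⟩
    (f (G , w) - f (G , w) + R) + ∑[ i < n ] (Rᵢ i + Sᵢ i)
      ≡⟨ cong (_+_ (f (G , w) - f (G , w) + R)) (∑-distrib-+ Rᵢ Sᵢ) ⟩
    (f (G , w) - f (G , w) + R) + (R + S)
      ≡⟨ collect (f (G , w)) R S ⟩
    + 2 * R + S
      ∎
    where
    open ≡-Reasoning
    Rᵢ Sᵢ : Fin n → ℤ
    Rᵢ i = f (G , w [ i ]≔ true) - f (G , w)
    Sᵢ i = ∑[ j < n ] (f (addEdge G i j , w) - f (G , w))
    R = risesᵛ (λ w′ → f (G , w′)) w
    S = rises (λ G′ → f (G′ , w)) G
    collect : ∀ x R S → x - x + R + (R + S) ≡ + 2 * R + S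
    collect = solve-∀

  ∑-rises : ∀ n (f : Graph n → ℤ) →
            ∑ₗ (allGraphs n) (rises f) ≡ ∑[ G ∈ allGraphs n ] (f G * (+ 2 * edgeExcess G))
  ∑-rises zero    f = cong (_+ 0ℤ) (sym (ℤ.*-zeroʳ (f tt)))
  ∑-rises (suc n) f = begin
    ∑ₗ (allGraphs (suc n)) (rises f)
      ≡⟨ ∑-allGraphs-suc n _ ⟩
    ∑[ G ∈ allGraphs n ] ∑[ w ∈ allBoolVecs n ] rises f (G , w)
      ≡⟨ ∑ₗ-cong (allGraphs n) (λ G → ∑ₗ-cong (allBoolVecs n) (rises-suc f G)) ⟩
    ∑[ G ∈ allGraphs n ] ∑[ w ∈ allBoolVecs n ]
      (+ 2 * risesᵛ (λ w′ → f (G , w′)) w + rises (λ G′ → f (G′ , w)) G)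
      ≡⟨ ∑ₗ-product-rule (allGraphs n) (allBoolVecs n) rises (λ G → + 2 * edgeExcess G)
                         (λ h w → + 2 * risesᵛ h w) (λ w → + 2 * excess w)
                         (∑-rises n) ∑-2risesᵛ (λ G w → f (G , w)) ⟩
    ∑[ G ∈ allGraphs n ] ∑[ w ∈ allBoolVecs n ] (f (G , w) * (+ 2 * excess w + + 2 * edgeExcess G))
      ≡⟨ ∑ₗ-cong (allGraphs n) (λ G → ∑ₗ-cong (allBoolVecs n) λ w →
           cong (f (G , w) *_) (sym (ℤ.*-distribˡ-+ (+ 2) (excess w) (edgeExcess G)))) ⟩
    ∑[ G ∈ allGraphs n ] ∑[ w ∈ allBoolVecs n ] (f (G , w) * (+ 2 * (excess w + edgeExcess G)))
      ≡⟨ ∑-allGraphs-suc n _ ⟨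
    ∑[ G ∈ allGraphs (suc n) ] (f G * (+ 2 * edgeExcess G))
      ∎
    where
    open ≡-Reasoning
    ∑-2risesᵛ : ∀ h → ∑[ w ∈ allBoolVecs n ] (+ 2 * risesᵛ h w)
                        ≡ ∑[ w ∈ allBoolVecs n ] (h w * (+ 2 * excess w))
    ∑-2risesᵛ h = begin
      ∑[ w ∈ allBoolVecs n ] (+ 2 * risesᵛ h w)
        ≡⟨ *-distribˡ-∑ₗ (allBoolVecs n) (+ 2) _ ⟨
      + 2 * ∑ₗ (allBoolVecs n) (risesᵛ h)
        ≡⟨ cong (+ 2 *_) (∑-risesᵛ n h) ⟩
      + 2 * ∑[ w ∈ allBoolVecs n ] (h w * excess w)
        ≡⟨ *-distribˡ-∑ₗ (allBoolVecs n) (+ 2) _ ⟩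
      ∑[ w ∈ allBoolVecs n ] (+ 2 * (h w * excess w))
        ≡⟨ ∑ₗ-cong (allBoolVecs n) (λ w → swap (h w) (excess w)) ⟩
      ∑[ w ∈ allBoolVecs n ] (h w * (+ 2 * excess w))
        ∎
      where
      swap : ∀ x e → + 2 * (x * e) ≡ x * (+ 2 * e)
      swap = solve-∀

  module _ {n} {G G′ H : Graph n} (G⊆G′ : G ⊆ G′) where

    IsEmbedding-antitone : ∀ {φ} → IsEmbedding G′ H φ → IsEmbedding G H φ
    IsEmbedding-antitone (φ-inj , φ-hom) = φ-inj , λ u v u~v → φ-hom u v (G⊆G′ u v u~v)

    numEmbeddings-antitone : numEmbeddings G′ H ℕ.≤ numEmbeddings G H
    numEmbeddings-antitone = length-filter-mono _ _ IsEmbedding-antitone (allMaps n n)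

  missing-edges-arith : ∀ {n N E L S q} {B : ℤ} → N ℕ.≤ n ℕ.* n → 0 ℕ.< L → L ℕ.≤ 2 ℕ.* S ℕ.* q →
                        + S * (+ N - + E) ≤ B → + 2 * + n * B ≤ (+ n * + n + + N) * + L →
                        N ℕ.≤ E ℕ.+ 2 ℕ.* q ℕ.* n
  missing-edges-arith {zero}  ℕ.z≤n _ _ _ _ = ℕ.z≤n
  missing-edges-arith {suc _} {S = zero} _ 0<L L≤0 _ _ = contradiction (ℕ.<-≤-trans 0<L L≤0) λ ()
  missing-edges-arith {n@(suc _)} {N} {E} {L} {S@(suc _)} {q} {B} N≤n*n _ L≤2Sq Sm≤B 2nB≤ =
    ℤ.drop‿+≤+ (begin
      + N                       ≡⟨ cancel (+ N) (+ E) ⟨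
      + N - + E + + E           ≤⟨ ℤ.+-monoˡ-≤ (+ E) m≤2qn ⟩
      + 2 * + q * + n + + E     ≡⟨ ℤ.+-comm (+ 2 * + q * + n) (+ E) ⟩
      + E + + 2 * + q * + n     ≡⟨ cong (_+_ (+ E)) (pos-2*m*n q n) ⟨
      + E + + (2 ℕ.* q ℕ.* n)   ≡⟨ ℤ.pos-+ E _ ⟨
      + (E ℕ.+ 2 ℕ.* q ℕ.* n)   ∎)
    where
    open ℤ.≤-Reasoning
    n² = + n * + n
    2n = + 2 * + n
    m = + N - + E
    cancel : ∀ N E → N - E + E ≡ N
    cancel = solve-∀
    reassoc : ∀ S T m → S * (T * m) ≡ T * (S * m)
    reassoc = solve-∀
    collect : ∀ n S q → (n * n + n * n) * (+ 2 * S * q) ≡ S * (+ 2 * n * (+ 2 * q * n))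
    collect = solve-∀
    pos-2*m*n : ∀ m n → + (2 ℕ.* m ℕ.* n) ≡ + 2 * + m * + n
    pos-2*m*n m n = trans (ℤ.pos-* (2 ℕ.* m) n) (cong (_* + n) (ℤ.pos-* 2 m))
    Sm≤S2qn : + S * (2n * m) ≤ + S * (2n * (+ 2 * + q * + n))
    Sm≤S2qn = begin
      + S * (2n * m)
        ≡⟨ reassoc (+ S) 2n m ⟩
      2n * (+ S * m)
        ≤⟨ ℤ.*-monoˡ-≤-nonNeg 2n Sm≤B ⟩
      2n * B
        ≤⟨ 2nB≤ ⟩
      (n² + + N) * + L
        ≤⟨ ℤ.*-monoʳ-≤-nonNeg (+ L) (ℤ.+-monoʳ-≤ n² (subst (+ N ≤_) (ℤ.pos-* n n) (+≤+ N≤n*n))) ⟩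
      (n² + n²) * + L
        ≤⟨ ℤ.*-monoˡ-≤-nonNeg (n² + n²) (subst (+ L ≤_) (pos-2*m*n S q) (+≤+ L≤2Sq)) ⟩
      (n² + n²) * (+ 2 * + S * + q)
        ≡⟨ collect (+ n) (+ S) (+ q) ⟩
      + S * (2n * (+ 2 * + q * + n))
        ∎
    m≤2qn : m ≤ + 2 * + q * + n
    m≤2qn = ℤ.*-cancelˡ-≤-pos _ _ 2n (ℤ.*-cancelˡ-≤-pos _ _ (+ S) Sm≤S2qn)

  module _ {n} (H : Graph n) where

    nonEmbeddable : Graph n → ℤ
    nonEmbeddable G = 𝟙 (does (numEmbeddings G H ℕ.≟ 0))

    rise : Graph n → Fin n → Fin n → ℤ
    rise G u v = nonEmbeddable (addEdge G u v) - nonEmbeddable G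

    nonEmbeddable-mono : ∀ {G G′} → G ⊆ G′ → nonEmbeddable G ≤ nonEmbeddable G′
    nonEmbeddable-mono G⊆G′ = 𝟙-≡0-antitone (numEmbeddings-antitone G⊆G′)

    rise-nonNeg : ∀ G u v → 0ℤ ≤ rise G u v
    rise-nonNeg G u v = ℤ.i≤j⇒0≤j-i (nonEmbeddable-mono (⊆-addEdge G u v))

    rises-nonNeg : ∀ G → 0ℤ ≤ rises nonEmbeddable G
    rises-nonNeg G = ∑-nonNeg λ u → ∑-nonNeg λ v → rise-nonNeg G u v

    module _ {G : Graph n} (G→*H : G →* H) where

      private
        unique = length-filter≡1⇒unique (λ φ → isEmbedding? G H (lookup φ)) (allMaps n n) G→*H
        φ = lookup (proj₁ unique)
        φ-emb : IsEmbedding G H φ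
        φ-emb = proj₁ (proj₂ unique)
        φ-inj : ∀ {i j} → φ i ≡ φ j → i ≡ j
        φ-inj = proj₁ φ-emb _ _

      -- Every embedding of G + uv is an embedding of G, hence equals φ, which does not preserve uv.
      addEdge-↛ : ∀ {u v} → u ≢ v → adj H (φ u) (φ v) ≡ false → numEmbeddings (addEdge G u v) H ≡ 0
      addEdge-↛ {u} {v} u≢v φuφv≡false = length-filter≡0 _ λ ψ∈ ψ-emb →
        case proj₂ (proj₂ unique) ψ∈ (IsEmbedding-antitone (⊆-addEdge G u v) ψ-emb) of λ where
          refl → contradiction (trans (sym (proj₂ ψ-emb u v (addEdge-adj G u≢v))) φuφv≡false) λ ()

      rise-at-non-edge : ∀ {u v} → u ≢ v → adj H (φ u) (φ v) ≡ false → rise G u v ≡ 1ℤ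
      rise-at-non-edge u≢v φuφv≡false =
        cong₂ (λ k m → 𝟙 (does (k ℕ.≟ 0)) - 𝟙 (does (m ℕ.≟ 0))) (addEdge-↛ u≢v φuφv≡false) G→*H

      1≤rise+adj+diag : ∀ u v → 1ℤ ≤ rise G u v + (𝟙 (adj H (φ u) (φ v)) + 𝟙 (does (u ≟ᶠ v)))
      1≤rise+adj+diag u v with u ≟ᶠ v | adj H (φ u) (φ v) in φuφv
      ... | yes _   | a     = ℤ.+-mono-≤ (rise-nonNeg G u v) (ℤ.+-mono-≤ (0≤𝟙 a) ℤ.≤-refl)
      ... | no  _   | true  = ℤ.+-mono-≤ (rise-nonNeg G u v) ℤ.≤-refl
      ... | no  u≢v | false = ℤ.≤-reflexive (sym (cong (_+ 0ℤ) (rise-at-non-edge u≢v φuφv)))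

      n*n≤rises+2e+n : + n * + n ≤ rises nonEmbeddable G + (+ 2 * + e H + + n)
      n*n≤rises+2e+n = begin
        + n * + n
          ≡⟨ ∑∑-1 n ⟨
        ∑[ u < n ] ∑[ v < n ] 1ℤ
          ≤⟨ ∑-mono-≤ (λ u → ∑-mono-≤ (1≤rise+adj+diag u)) ⟩
        ∑[ u < n ] ∑[ v < n ] (rise G u v + (adjφ u v + diag u v))
          ≡⟨ ∑∑-distrib-+ (rise G) _ ⟩
        rises nonEmbeddable G + ∑[ u < n ] ∑[ v < n ] (adjφ u v + diag u v)
          ≡⟨ cong (_+_ (rises nonEmbeddable G)) (∑∑-distrib-+ adjφ diag) ⟩
        rises nonEmbeddable G + (∑[ u < n ] ∑[ v < n ] adjφ u v + ∑[ u < n ] ∑[ v < n ] diag u v)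
          ≤⟨ ℤ.+-monoʳ-≤ (rises nonEmbeddable G) (ℤ.+-mono-≤ (∑∑-adj-injective-≤ H φ-inj) (ℤ.≤-reflexive ∑∑-𝟙-≟)) ⟩
        rises nonEmbeddable G + (+ 2 * + e H + + n)
          ∎
        where
        open ℤ.≤-Reasoning
        adjφ diag : Fin n → Fin n → ℤ
        adjφ u v = 𝟙 (adj H (φ u) (φ v))
        diag u v = 𝟙 (does (u ≟ᶠ v))

      rises-lower-bound : + 2 * (+ choose2 n - + e H) ≤ rises nonEmbeddable G
      rises-lower-bound = begin
        + 2 * (+ choose2 n - + e H)
          ≡⟨ regroup (+ choose2 n) (+ e H) (+ n) ⟩
        (+ 2 * + choose2 n + + n) - (+ 2 * + e H + + n)
          ≡⟨ cong (_- (+ 2 * + e H + + n)) (n*n≡2*choose2+n n) ⟨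
        + n * + n - (+ 2 * + e H + + n)
          ≤⟨ ℤ.+-monoˡ-≤ (- (+ 2 * + e H + + n)) n*n≤rises+2e+n ⟩
        rises nonEmbeddable G + (+ 2 * + e H + + n) - (+ 2 * + e H + + n)
          ≡⟨ cancel (rises nonEmbeddable G) _ ⟩
        rises nonEmbeddable G
          ∎
        where
        open ℤ.≤-Reasoning
        regroup : ∀ N E n → + 2 * (N - E) ≡ (+ 2 * N + n) - (+ 2 * E + n)
        regroup = solve-∀
        cancel : ∀ r x → r + x - x ≡ r
        cancel = solve-∀

    rises-bound : ∀ G → + 2 * (+ choose2 n - + e H) * 𝟙 (does (numEmbeddings G H ℕ.≟ 1))
                          ≤ rises nonEmbeddable G
    rises-bound G = by-cases (numEmbeddings G H ℕ.≟ 1)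
      where
      2m = + 2 * (+ choose2 n - + e H)
      by-cases : (G→*H? : Dec (G →* H)) → 2m * 𝟙 (does G→*H?) ≤ rises nonEmbeddable G
      by-cases (yes G→*H) = subst (_≤ rises nonEmbeddable G) (sym (ℤ.*-identityʳ 2m)) (rises-lower-bound G→*H)
      by-cases (no  _)    = subst (_≤ rises nonEmbeddable G) (sym (ℤ.*-zeroʳ 2m)) (rises-nonNeg G)

    countUnique-bound : + countUnique H * (+ choose2 n - + e H)
                          ≤ ∑[ G ∈ allGraphs n ] (nonEmbeddable G * edgeExcess G)
    countUnique-bound = ℤ.*-cancelˡ-≤-pos _ _ (+ 2) (begin
      + 2 * (+ countUnique H * m)
        ≡⟨ regroup (+ countUnique H) m ⟩
      + 2 * m * + countUnique H
        ≡⟨ cong (+ 2 * m *_) (length-filter≡∑ₗ𝟙 _ (allGraphs n)) ⟩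
      + 2 * m * ∑[ G ∈ allGraphs n ] 𝟙 (does (numEmbeddings G H ℕ.≟ 1))
        ≡⟨ *-distribˡ-∑ₗ (allGraphs n) (+ 2 * m) _ ⟩
      ∑[ G ∈ allGraphs n ] (+ 2 * m * 𝟙 (does (numEmbeddings G H ℕ.≟ 1)))
        ≤⟨ ∑ₗ-mono-≤ (allGraphs n) rises-bound ⟩
      ∑ₗ (allGraphs n) (rises nonEmbeddable)
        ≡⟨ ∑-rises n nonEmbeddable ⟩
      ∑[ G ∈ allGraphs n ] (nonEmbeddable G * (+ 2 * edgeExcess G))
        ≡⟨ ∑ₗ-cong (allGraphs n) (λ G → swap (nonEmbeddable G) (edgeExcess G)) ⟩
      ∑[ G ∈ allGraphs n ] (+ 2 * (nonEmbeddable G * edgeExcess G))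
        ≡⟨ *-distribˡ-∑ₗ (allGraphs n) (+ 2) _ ⟨
      + 2 * ∑[ G ∈ allGraphs n ] (nonEmbeddable G * edgeExcess G)
        ∎)
      where
      open ℤ.≤-Reasoning
      m = + choose2 n - + e H
      regroup : ∀ S m → + 2 * (S * m) ≡ + 2 * m * S
      regroup = solve-∀
      swap : ∀ f a → f * (+ 2 * a) ≡ + 2 * (f * a)
      swap = solve-∀

    nonEmbeddable-edgeExcess-bound : + 2 * + n * ∑[ G ∈ allGraphs n ] (nonEmbeddable G * edgeExcess G)
                                       ≤ (+ n * + n + + choose2 n) * + (2 ℕ.^ choose2 n)
    nonEmbeddable-edgeExcess-bound = begin
      + 2 * + n * ∑[ G ∈ allGraphs n ] (nonEmbeddable G * edgeExcess G)
        ≤⟨ ∑ₗ-cross-≤ (allGraphs n) nonEmbeddable edgeExcess (+ n) (λ G → 𝟙*𝟙≤1 (does (numEmbeddings G H ℕ.≟ 0))) ⟩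
      + n * + n * ∑[ _ ∈ allGraphs n ] 1ℤ + ∑[ G ∈ allGraphs n ] (edgeExcess G * edgeExcess G)
        ≡⟨ cong₂ (λ s t → + n * + n * s + t) (∑-allGraphs-1 n) (∑-edgeExcess² n) ⟩
      + n * + n * + (2 ℕ.^ choose2 n) + + choose2 n * + (2 ℕ.^ choose2 n)
        ≡⟨ ℤ.*-distribʳ-+ (+ (2 ℕ.^ choose2 n)) (+ n * + n) (+ choose2 n) ⟨
      (+ n * + n + + choose2 n) * + (2 ℕ.^ choose2 n)
        ∎
      where open ℤ.≤-Reasoning

    few-missing-edges : ∀ q → 2 ℕ.^ choose2 n ℕ.≤ 2 ℕ.* countUnique H ℕ.* q →
                        choose2 n ℕ.≤ e H ℕ.+ 2 ℕ.* q ℕ.* n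
    few-missing-edges q 2ᴺ≤2Sq =
      missing-edges-arith {n} {choose2 n} {e H} {S = countUnique H}
        choose2≤n*n (ℕ.m^n>0 2 (choose2 n)) 2ᴺ≤2Sq countUnique-bound nonEmbeddable-edgeExcess-bound
      where
      choose2≤n*n : choose2 n ℕ.≤ n ℕ.* n
      choose2≤n*n = ℕ.≤-trans (ℕ.m≤m+n (choose2 n) _)
                      (ℕ.≤-trans (ℕ.m≤m+n _ n) (ℕ.≤-reflexive (2*choose2+n≡n*n n)))

  δ*a≤b⇒a≤b*↧δ : ∀ δ → Positive δ → ∀ a b → δ ℚ.* ((+ a) ℚ./ 1) ℚ.≤ (+ b) ℚ./ 1 → a ℕ.≤ b ℕ.* ↧ₙ δ
  δ*a≤b⇒a≤b*↧δ δ@(mkℚ +[1+ p ] d _) _ a b δa≤b =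
    cross-multiply (ℚᵘ.≤-respˡ-≃ (ℚ.toℚᵘ-homo-* δ (a /1))
                     (ℚ.toℚᵘ-mono-≤ (subst₂ (λ x y → δ ℚ.* x ℚ.≤ y) (integral a) (integral b) δa≤b)))
    where
    _/1 : ℕ → ℚ
    k /1 = mkℚ (+ k) 0 (coprime-sym (1-coprimeTo k))
    integral : ∀ k → (+ k) ℚ./ 1 ≡ k /1
    integral k = ℚ.normalize-coprime (coprime-sym (1-coprimeTo k))
    cross-multiply : ℚ.toℚᵘ δ ℚᵘ.* ℚ.toℚᵘ (a /1) ℚᵘ.≤ ℚ.toℚᵘ (b /1) → a ℕ.≤ b ℕ.* suc d
    cross-multiply (ℚᵘ.*≤* p[1+a]≤b[1+d]) =
      ℕ.≤-trans (ℕ.m≤n*m a (suc p))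
        (subst (λ t → suc p ℕ.* a ℕ.≤ b ℕ.* suc t) (ℕ.*-identityʳ d)
          (ℤ.drop‿+≤+ (subst₂ _≤_ (trans (ℤ.*-identityʳ _) (ℤ.+◃n≡+n _)) (sym (ℤ.pos-* b _)) p[1+a]≤b[1+d])))

open import Data.Nat using (ℕ; _+_; _*_; _^_; _≤_)
open import Data.Nat.Combinatorics using (_C_)
open import Data.Integer using (+_)
open import Data.Rational using (ℚ; _/_; Positive; ↧ₙ_) renaming (_*_ to _*ℚ_; _≤_ to _≤ℚ_)
open import Data.Product using (Σ; _,_)
open import Relation.Binary.PropositionalEquality using (subst; sym)

lemma2p2 : (δ : ℚ) → Positive δ →
    Σ ℕ (λ K → (n : ℕ) (H : Graph n) →
      δ *ℚ ((+ (2 ^ (n C 2))) / 1) ≤ℚ ((+ (2 * countUnique H)) / 1) →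
      n C 2 ≤ e H + K * n)
lemma2p2 δ δ>0 = 2 * ↧ₙ δ , λ n H δ2ᴺ≤2S →
  subst (_≤ e H + 2 * ↧ₙ δ * n) (choose2≡nC2 n)
    (few-missing-edges H (↧ₙ δ)
      (subst (λ N → 2 ^ N ≤ 2 * countUnique H * ↧ₙ δ) (sym (choose2≡nC2 n))
        (δ*a≤b⇒a≤b*↧δ δ δ>0 (2 ^ (n C 2)) (2 * countUnique H) δ2ᴺ≤2S)))
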